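{- Let $p_1,\dots,p_\ell$ be $\ell$ pairwise distinct primes and let $a$ be an integer with $(a,p_1\cdots p_\ell)=1$. Then $a$ is a generalized primitive root modulo $p_1\cdots p_\ell$ if and only if for every prime $q$ dividing $\lambda(p_1\cdots p_\ell)$ there exists $p\in M_q(p_1,\dots,p_\ell)$ such that $a$ is not congruent to a $q$-th power modulo $p$.
   Context: $\lambda$ is Carmichael's function; $a$ is a generalized primitive root modulo $n$ if $(a,n)=1$ and the multiplicative order of $a$ modulo $n$ equals $\lambda(n)$. For a prime $q$, $\nu_q$ denotes the $q$-adic valuation and $M_q(p_1,\dots,p_\ell):=\{p\in\{p_1,\dots,p_\ell\}:\ \nu_q(p-1)=\nu_q(\lambda(p_1\cdots p_\ell))\}$. -}

module Defs where

open import Data.Nat using (ℕ; zero; suc; _*_; _∸_; _≤_; _<_)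
open import Data.Nat.Divisibility using () renaming (_∣_ to _∣ℕ_)
open import Data.Nat.Coprimality using (Coprime)
open import Data.Fin using (Fin; zero; suc)
open import Data.Integer using (ℤ; +_; _-_; ∣_∣) renaming (_^_ to _^ℤ_)
open import Data.Integer.Divisibility using (_∣_)
open import Data.Product using (_×_; ∃)
open import Relation.Nullary using (¬_)

prodFin : ∀ {ℓ} → (Fin ℓ → ℕ) → ℕ
prodFin {zero}  f = 1
prodFin {suc ℓ} f = f zero * prodFin (λ i → f (suc i))

_≡_[mod_] : ℤ → ℤ → ℕ → Set
x ≡ y [mod n ] = (+ n) ∣ (x - y)

CoprimeZ : ℤ → ℕ → Set
CoprimeZ a n = Coprime ∣ a ∣ n

IsOrder : ℕ → ℤ → ℕ → Set
IsOrder n a k =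
  0 < k × (a ^ℤ k) ≡ + 1 [mod n ]
  × (∀ j → 0 < j → (a ^ℤ j) ≡ + 1 [mod n ] → k ≤ j)

IsCarmichaelλ : ℕ → ℕ → Set
IsCarmichaelλ n L =
  0 < L × (∀ (a : ℤ) → CoprimeZ a n → (a ^ℤ L) ≡ + 1 [mod n ])
  × (∀ m → 0 < m → (∀ (a : ℤ) → CoprimeZ a n → (a ^ℤ m) ≡ + 1 [mod n ]) → L ≤ m)

-- a is a generalized primitive root modulo n, where L = λ(n):
-- (a , n) = 1 and the multiplicative order of a modulo n equals λ(n)
IsGenPrimRoot : ℕ → ℕ → ℤ → Set
IsGenPrimRoot n L a = CoprimeZ a n × IsOrder n a L

IsValuation : ℕ → ℕ → ℕ → Set
IsValuation q m v = (q Data.Nat.^ v) ∣ℕ m × ¬ ((q Data.Nat.^ suc v) ∣ℕ m)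

-- p ∈ M_q(p₁,…,p_ℓ) given L = λ(p₁⋯p_ℓ):  p is one of the p_i and ν_q(p-1) = ν_q(L)
InM : ∀ {ℓ} → ℕ → ℕ → (Fin ℓ → ℕ) → ℕ → Set
InM q L ps p = ∃ λ i → ps i Relation.Binary.PropositionalEquality.≡ p
  × ∃ λ v → IsValuation q (p ∸ 1) v × IsValuation q L v
  where import Relation.Binary.PropositionalEquality

IsPowerMod : ℕ → ℕ → ℤ → Set
IsPowerMod q p a = ∃ λ (x : ℤ) → a ≡ (x ^ℤ q) [mod p ]

module Submission where

-- Write L = λ(p₁⋯p_ℓ). An a whose order divides L has order exactly L iff
-- a^(L/q) ≢ 1 for every prime q ∣ L, and as the modulus is squarefree this
-- congruence can be tested modulo each pᵢ separately, where pᵢ - 1 ∣ L. If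
-- ν_q(pᵢ - 1) < ν_q(L) then pᵢ - 1 ∣ L/q, so a^(L/q) ≡ 1 (mod pᵢ) by Fermat.
-- If pᵢ ∈ M_q then gcd(L/q, pᵢ - 1) divides (pᵢ - 1)/q, so a^(L/q) ≡ 1 (mod pᵢ)
-- iff a^((pᵢ-1)/q) ≡ 1 (mod pᵢ), iff a is a q-th power modulo pᵢ by Euler's
-- criterion. Both Euler's criterion and pᵢ - 1 ∣ L rest on Lagrange's bound
-- on the number of roots of a polynomial modulo a prime.

open import Defs
import Algebra.Definitions.RawSemiring
import Algebra.Properties.CommutativeSemigroup as CommutativeSemigroupProperties
import Algebra.Properties.CommutativeSemiring.Binomial as Binomial
open import Data.Empty using (⊥; ⊥-elim)
open import Data.Fin as Fin using (Fin; zero; suc; toℕ)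
import Data.Fin.Properties as Finₚ
open import Data.Integer as ℤ using (ℤ; +_; _+_; _*_; -_; _-_; ∣_∣) renaming (_^_ to _^ℤ_)
open import Data.Integer.DivMod using (_%ℕ_; _/ℕ_; a≡a%ℕn+[a/ℕn]*n; n%ℕd<d)
open import Data.Integer.Divisibility.Signed as ℤ∣
  using (divides; ∣m∣n⇒∣m+n; ∣m⇒∣-m; ∣n⇒∣m*n; ∣m⇒∣m*n) renaming (_∣_ to _∣ℤ_)
import Data.Integer.Properties as ℤₚ
open import Data.Integer.Tactic.RingSolver using (solve-∀)
open import Data.List using (List; []; _∷_; length; _++_; replicate)
import Data.List.Properties as Listₚ
open import Data.List.Relation.Unary.All using (All; []; _∷_)
open import Data.Nat as ℕ using (ℕ; zero; suc; _≤_; _<_; _∸_; _^_; z≤n; s≤s; NonZero)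
open import Data.Nat.Combinatorics using (_C_; nCn≡1; nC1≡n; nCk+nC[k+1]≡[n+1]C[k+1])
open import Data.Nat.Coprimality using (Coprime; coprime-divisor)
open import Data.Nat.Divisibility as ℕ∣ using (_∣_; divides; _∣?_; ∣-trans; ∣-refl)
open import Data.Nat.DivMod using (_%_; _/_; m≡m%n+[m/n]*n; m%n<n)
open import Data.Nat.GCD using (gcd; gcd[m,n]∣m; gcd[m,n]∣n; gcd-GCD; module Bézout)
open import Data.Nat.Induction using (<-rec)
open import Data.Nat.ListAction using (product)
open import Data.Nat.Primality
  using (Prime; euclidsLemma; prime⇒irreducible; prime⇒nonZero; prime⇒nonTrivial)
open import Data.Nat.Primality.Factorisation using (factorise; module PrimeFactorisation)
import Data.Nat.Properties as ℕₚ
open import Data.Nat.Tactic.RingSolver using () renaming (solve-∀ to ℕ-solve-∀)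
open import Data.Product using (_×_; _,_; ∃; proj₁; proj₂)
open import Data.Sum using (_⊎_; inj₁; inj₂; [_,_]′)
open import Data.Vec.Functional as Vec using (Vector)
open import Function.Base using (_∘_; id; flip)
open import Function.Bundles using (_⇔_; mk⇔; Equivalence)
open import Relation.Binary.Bundles using (Setoid)
open import Relation.Binary.Definitions using (tri<; tri≈; tri>)
open import Relation.Binary.PropositionalEquality as ≡
  using (_≡_; refl; sym; trans; cong; cong₂; subst)
open import Relation.Nullary using (¬_; Dec; yes; no)
open import Relation.Nullary.Decidable using (map′; _×-dec_; ¬?; decidable-stable)

open CommutativeSemigroupProperties ℕₚ.*-commutativeSemigroup
  using (x∙yz≈y∙xz; x∙yz≈xz∙y; xy∙z≈xz∙y)

prime>1 : ∀ {p} → Prime p → 1 < p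
prime>1 {p} p-prime = ℕ.nonTrivial⇒n>1 p {{prime⇒nonTrivial p-prime}}

prime>0 : ∀ {p} → Prime p → 0 < p
prime>0 p-prime = ℕₚ.<-trans (s≤s z≤n) (prime>1 p-prime)

≤∸1⇒< : ∀ {j n} → 0 < n → j ≤ n ∸ 1 → j < n
≤∸1⇒< {n = suc _} _ j≤n-1 = s≤s j≤n-1

-- Congruences

-- An inductive copy of _≡_[mod_]: its arguments, unlike those of the
-- latter, can be inferred by unification.
infix 4 _≋_[mod_]
record _≋_[mod_] (x y : ℤ) (n : ℕ) : Set where
  constructor mk≋
  field ∣-difference : + n ∣ℤ x - y
open _≋_[mod_] public

≡-mod⇒≋ : ∀ {n x y} → x ≡ y [mod n ] → x ≋ y [mod n ]
≡-mod⇒≋ n∣x-y = mk≋ (ℤ∣.∣ᵤ⇒∣ n∣x-y)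

≋⇒≡-mod : ∀ {n x y} → x ≋ y [mod n ] → x ≡ y [mod n ]
≋⇒≡-mod x≋y = ℤ∣.∣⇒∣ᵤ (∣-difference x≋y)

∣ℤ⇒∣ : ∀ {n x} → + n ∣ℤ x → n ∣ ∣ x ∣
∣ℤ⇒∣ = ℤ∣.∣⇒∣ᵤ

∣⇒∣ℤ : ∀ {n} x → n ∣ ∣ x ∣ → + n ∣ℤ x
∣⇒∣ℤ x = ℤ∣.∣ᵤ⇒∣

∣ℤ-respects : ∀ {n x y} → x ≡ y → + n ∣ℤ x → + n ∣ℤ y
∣ℤ-respects refl n∣x = n∣x

∣ℤ0 : ∀ {n} → + n ∣ℤ + 0
∣ℤ0 = divides (+ 0) refl

∣⇒∣^ : ∀ {n x} k → 0 < k → + n ∣ℤ x → + n ∣ℤ x ^ℤ k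
∣⇒∣^ {x = x} (suc k) _ n∣x = ∣m⇒∣m*n (x ^ℤ k) n∣x

module _ {n : ℕ} where

  ≋-refl : ∀ {x} → x ≋ x [mod n ]
  ≋-refl {x} = mk≋ (∣ℤ-respects (sym (ℤₚ.+-inverseʳ x)) ∣ℤ0)

  ≋-reflexive : ∀ {x y} → x ≡ y → x ≋ y [mod n ]
  ≋-reflexive refl = ≋-refl

  ≋-sym : ∀ {x y} → x ≋ y [mod n ] → y ≋ x [mod n ]
  ≋-sym {x} {y} (mk≋ n∣x-y) = mk≋ (∣ℤ-respects (negate x y) (∣m⇒∣-m n∣x-y))
    where negate : ∀ x y → - (x - y) ≡ y - x
          negate = solve-∀

  ≋-trans : ∀ {x y z} → x ≋ y [mod n ] → y ≋ z [mod n ] → x ≋ z [mod n ]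
  ≋-trans {x} {y} {z} (mk≋ n∣x-y) (mk≋ n∣y-z) =
    mk≋ (∣ℤ-respects (telescope x y z) (∣m∣n⇒∣m+n n∣x-y n∣y-z))
    where telescope : ∀ x y z → (x - y) + (y - z) ≡ x - z
          telescope = solve-∀

  +-cong-≋ : ∀ {x x′ y y′} → x ≋ x′ [mod n ] → y ≋ y′ [mod n ] → x + y ≋ x′ + y′ [mod n ]
  +-cong-≋ {x} {x′} {y} {y′} (mk≋ n∣x-x′) (mk≋ n∣y-y′) =
    mk≋ (∣ℤ-respects (regroup x x′ y y′) (∣m∣n⇒∣m+n n∣x-x′ n∣y-y′))
    where regroup : ∀ x x′ y y′ → (x - x′) + (y - y′) ≡ (x + y) - (x′ + y′)
          regroup = solve-∀

  *-cong-≋ : ∀ {x x′ y y′} → x ≋ x′ [mod n ] → y ≋ y′ [mod n ] → x * y ≋ x′ * y′ [mod n ]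
  *-cong-≋ {x} {x′} {y} {y′} (mk≋ n∣x-x′) (mk≋ n∣y-y′) =
    mk≋ (∣ℤ-respects (regroup x x′ y y′) (∣m∣n⇒∣m+n (∣n⇒∣m*n x n∣y-y′) (∣m⇒∣m*n y′ n∣x-x′)))
    where regroup : ∀ x x′ y y′ → x * (y - y′) + (x - x′) * y′ ≡ x * y - x′ * y′
          regroup = solve-∀

  ^-cong-≋ : ∀ {x x′} k → x ≋ x′ [mod n ] → x ^ℤ k ≋ x′ ^ℤ k [mod n ]
  ^-cong-≋ zero    x≋x′ = ≋-refl
  ^-cong-≋ (suc k) x≋x′ = *-cong-≋ x≋x′ (^-cong-≋ k x≋x′)

  ∣⇒≋0 : ∀ {x} → + n ∣ℤ x → x ≋ + 0 [mod n ]
  ∣⇒≋0 {x} n∣x = mk≋ (∣ℤ-respects (sym (ℤₚ.+-identityʳ x)) n∣x)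

  ≋0⇒∣ : ∀ {x} → x ≋ + 0 [mod n ] → + n ∣ℤ x
  ≋0⇒∣ {x} (mk≋ n∣x-0) = ∣ℤ-respects (ℤₚ.+-identityʳ x) n∣x-0

  ∣-respects-≋ : ∀ {x y} → x ≋ y [mod n ] → + n ∣ℤ y → + n ∣ℤ x
  ∣-respects-≋ {x} {y} (mk≋ n∣x-y) n∣y = ∣ℤ-respects (cancel x y) (∣m∣n⇒∣m+n n∣x-y n∣y)
    where cancel : ∀ x y → (x - y) + y ≡ x
          cancel = solve-∀

  ≋-setoid : Setoid _ _
  ≋-setoid = record
    { Carrier = ℤ
    ; _≈_ = _≋_[mod n ]
    ; isEquivalence = record { refl = ≋-refl ; sym = ≋-sym ; trans = ≋-trans }
    }

module ≋-Reasoning (n : ℕ) where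
  open import Relation.Binary.Reasoning.Setoid (≋-setoid {n}) public

≋-weaken : ∀ {m n x y} → m ∣ n → x ≋ y [mod n ] → x ≋ y [mod m ]
≋-weaken m∣n (mk≋ n∣x-y) = mk≋ (ℤ∣.∣-trans (ℤ∣.∣ᵤ⇒∣ m∣n) n∣x-y)

≋-dec : ∀ n x y → Dec (x ≋ y [mod n ])
≋-dec n x y = map′ mk≋ ∣-difference (+ n ℤ∣.∣? (x - y))

≋-%ℕ : ∀ n .{{_ : NonZero n}} x → x ≋ + (x %ℕ n) [mod n ]
≋-%ℕ n x = mk≋ (∣ℤ-respects (sym multiple) (∣n⇒∣m*n (x /ℕ n) ℤ∣.∣-refl))
  where
    cancel : ∀ r m → r + m - r ≡ m
    cancel = solve-∀
    multiple : x - + (x %ℕ n) ≡ (x /ℕ n) * + n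
    multiple = trans (cong (_- + (x %ℕ n)) (a≡a%ℕn+[a/ℕn]*n x n)) (cancel (+ (x %ℕ n)) _)

IsPowerMod-dec : ∀ q p .{{_ : NonZero p}} a → Dec (IsPowerMod q p a)
IsPowerMod-dec q p a with Finₚ.any? (λ (r : Fin p) → ≋-dec p a ((+ toℕ r) ^ℤ q))
... | yes (r , a≋rᵠ) = yes (+ toℕ r , ≋⇒≡-mod a≋rᵠ)
... | no  ¬small     = no λ (x , a≡xᵠ) → ¬small (residue x , a≋residueᵠ x (≡-mod⇒≋ a≡xᵠ))
  where
    residue : ℤ → Fin p
    residue x = Fin.fromℕ< (n%ℕd<d x p)
    a≋residueᵠ : ∀ x → a ≋ x ^ℤ q [mod p ] → a ≋ (+ toℕ (residue x)) ^ℤ q [mod p ]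
    a≋residueᵠ x a≋xᵠ = ≋-trans a≋xᵠ (^-cong-≋ q (subst (λ r → x ≋ + r [mod p ])
                          (sym (Finₚ.toℕ-fromℕ< (n%ℕd<d x p))) (≋-%ℕ p x)))

module _ {n : ℕ} (a : ℤ) where
  open ≋-Reasoning n

  ^≋1-∣ : ∀ {d k} → d ∣ k → a ^ℤ d ≋ + 1 [mod n ] → a ^ℤ k ≋ + 1 [mod n ]
  ^≋1-∣ {d} (divides c refl) aᵈ≋1 = begin
    a ^ℤ (c ℕ.* d)     ≡⟨ cong (a ^ℤ_) (ℕₚ.*-comm c d) ⟩
    a ^ℤ (d ℕ.* c)     ≡⟨ ℤₚ.^-*-assoc a d c ⟨
    (a ^ℤ d) ^ℤ c      ≈⟨ ^-cong-≋ c aᵈ≋1 ⟩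
    (+ 1) ^ℤ c         ≡⟨ ℤₚ.^-zeroˡ c ⟩
    + 1                ∎

  ^≋1-+ : ∀ d e {f} → d ℕ.+ e ≡ f →
          a ^ℤ f ≋ + 1 [mod n ] → a ^ℤ e ≋ + 1 [mod n ] → a ^ℤ d ≋ + 1 [mod n ]
  ^≋1-+ d e refl aᵈ⁺ᵉ≋1 aᵉ≋1 = begin
    a ^ℤ d              ≡⟨ ℤₚ.*-identityʳ (a ^ℤ d) ⟨
    a ^ℤ d * + 1        ≈⟨ *-cong-≋ (≋-refl {x = a ^ℤ d}) (≋-sym aᵉ≋1) ⟩
    a ^ℤ d * a ^ℤ e     ≡⟨ ℤₚ.^-distribˡ-+-* a d e ⟨
    a ^ℤ (d ℕ.+ e)      ≈⟨ aᵈ⁺ᵉ≋1 ⟩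
    + 1                 ∎

  ^≋1-gcd : ∀ j k → a ^ℤ j ≋ + 1 [mod n ] → a ^ℤ k ≋ + 1 [mod n ] → a ^ℤ gcd j k ≋ + 1 [mod n ]
  ^≋1-gcd j k aʲ≋1 aᵏ≋1 with Bézout.identity (gcd-GCD j k)
  ... | Bézout.+- x y eq = ^≋1-+ (gcd j k) (y ℕ.* k) eq (^≋1-∣ (ℕ∣.n∣m*n x) aʲ≋1) (^≋1-∣ (ℕ∣.n∣m*n y) aᵏ≋1)
  ... | Bézout.-+ x y eq = ^≋1-+ (gcd j k) (x ℕ.* j) eq (^≋1-∣ (ℕ∣.n∣m*n y) aᵏ≋1) (^≋1-∣ (ℕ∣.n∣m*n x) aʲ≋1)

-- Prime moduli

module _ {p : ℕ} (p-prime : Prime p) where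

  prime∣*⇒∣⊎∣ : ∀ x y → + p ∣ℤ x * y → + p ∣ℤ x ⊎ + p ∣ℤ y
  prime∣*⇒∣⊎∣ x y p∣xy
    with euclidsLemma ∣ x ∣ ∣ y ∣ p-prime (subst (p ∣_) (ℤₚ.abs-* x y) (∣ℤ⇒∣ p∣xy))
  ... | inj₁ p∣x = inj₁ (∣⇒∣ℤ x p∣x)
  ... | inj₂ p∣y = inj₂ (∣⇒∣ℤ y p∣y)

  prime∣*∧∤⇒∣ : ∀ x y → + p ∣ℤ x * y → ¬ + p ∣ℤ x → + p ∣ℤ y
  prime∣*∧∤⇒∣ x y p∣xy p∤x = [ ⊥-elim ∘ p∤x , id ]′ (prime∣*⇒∣⊎∣ x y p∣xy)

  prime∣^⇒∣ : ∀ x k → + p ∣ℤ x ^ℤ k → + p ∣ℤ x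
  prime∣^⇒∣ x zero    p∣1 = ⊥-elim (ℕₚ.<⇒≢ (prime>1 p-prime) (sym (ℕ∣.∣1⇒≡1 (∣ℤ⇒∣ p∣1))))
  prime∣^⇒∣ x (suc k) p∣xxᵏ with prime∣*⇒∣⊎∣ x (x ^ℤ k) p∣xxᵏ
  ... | inj₁ p∣x  = p∣x
  ... | inj₂ p∣xᵏ = prime∣^⇒∣ x k p∣xᵏ

  coprime⇒prime∤ : ∀ {n} a → p ∣ n → CoprimeZ a n → ¬ + p ∣ℤ a
  coprime⇒prime∤ a p∣n a⊥n p∣a = ℕₚ.<⇒≢ (prime>1 p-prime) (sym (a⊥n (∣ℤ⇒∣ p∣a , p∣n)))

¬∣ℤ-small : ∀ {p j} → 0 < j → j < p → ¬ + p ∣ℤ + j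
¬∣ℤ-small 0<j j<p p∣j = ℕₚ.<⇒≱ j<p (ℕ∣.∣⇒≤ {{ℕ.>-nonZero 0<j}} (∣ℤ⇒∣ p∣j))

<⇒≉-mod : ∀ {p i j} → i < j → j < p → ¬ + i ≋ + j [mod p ]
<⇒≉-mod {p} {i} {j} i<j j<p (mk≋ p∣i-j) =
  ¬∣ℤ-small (ℕₚ.m<n⇒0<n∸m i<j) (ℕₚ.≤-<-trans (ℕₚ.m∸n≤m j i) j<p) (∣⇒∣ℤ (+ (j ∸ i)) p∣j-i)
  where
    p∣j-i : p ∣ j ∸ i
    p∣j-i = subst (p ∣_) (trans (cong ∣_∣ (ℤₚ.m-n≡m⊖n i j)) (ℤₚ.∣⊖∣-< i<j)) (∣ℤ⇒∣ p∣i-j)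

-- Fermat's little theorem

[1+k]*[1+n]C[1+k]≡[1+n]*nCk : ∀ n k → suc k ℕ.* (suc n C suc k) ≡ suc n ℕ.* (n C k)
[1+k]*[1+n]C[1+k]≡[1+n]*nCk zero    zero    = refl
[1+k]*[1+n]C[1+k]≡[1+n]*nCk zero    (suc k) = ℕₚ.*-zeroʳ (suc (suc k))
[1+k]*[1+n]C[1+k]≡[1+n]*nCk (suc n) zero    =
  trans (ℕₚ.*-identityˡ _) (trans (nC1≡n (2 ℕ.+ n)) (sym (ℕₚ.*-identityʳ _)))
[1+k]*[1+n]C[1+k]≡[1+n]*nCk (suc n) (suc k) = begin
  (2 ℕ.+ k) ℕ.* (suc (suc n) C suc (suc k))
    ≡⟨ cong ((2 ℕ.+ k) ℕ.*_) (nCk+nC[k+1]≡[n+1]C[k+1] (suc n) (suc k)) ⟨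
  (2 ℕ.+ k) ℕ.* (A ℕ.+ B)
    ≡⟨ expand k A B ⟩
  suc k ℕ.* A ℕ.+ A ℕ.+ (2 ℕ.+ k) ℕ.* B
    ≡⟨ cong₂ (λ u v → u ℕ.+ A ℕ.+ v)
             ([1+k]*[1+n]C[1+k]≡[1+n]*nCk n k) ([1+k]*[1+n]C[1+k]≡[1+n]*nCk n (suc k)) ⟩
  suc n ℕ.* (n C k) ℕ.+ A ℕ.+ suc n ℕ.* (n C suc k)
    ≡⟨ collect n (n C k) (n C suc k) A ⟩
  suc n ℕ.* ((n C k) ℕ.+ (n C suc k)) ℕ.+ A
    ≡⟨ cong (λ u → suc n ℕ.* u ℕ.+ A) (nCk+nC[k+1]≡[n+1]C[k+1] n k) ⟩
  suc n ℕ.* A ℕ.+ A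
    ≡⟨ ℕₚ.+-comm (suc n ℕ.* A) A ⟩
  (2 ℕ.+ n) ℕ.* A ∎
  where
    open ≡.≡-Reasoning
    A B : ℕ
    A = suc n C suc k
    B = suc n C suc (suc k)
    expand : ∀ k A B → (2 ℕ.+ k) ℕ.* (A ℕ.+ B) ≡ suc k ℕ.* A ℕ.+ A ℕ.+ (2 ℕ.+ k) ℕ.* B
    expand = ℕ-solve-∀
    collect : ∀ n c₀ c₁ A → suc n ℕ.* c₀ ℕ.+ A ℕ.+ suc n ℕ.* c₁ ≡ suc n ℕ.* (c₀ ℕ.+ c₁) ℕ.+ A
    collect = ℕ-solve-∀

prime∣pCk : ∀ {p} → Prime p → ∀ k → 0 < k → k < p → p ∣ (p C k)
prime∣pCk {suc n} p-prime (suc k) _ k<p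
  with euclidsLemma (suc k) (suc n C suc k) p-prime
         (subst (suc n ∣_) (sym ([1+k]*[1+n]C[1+k]≡[1+n]*nCk n k)) (ℕ∣.∣m⇒∣m*n (n C k) ∣-refl))
... | inj₂ p∣pCk = p∣pCk
... | inj₁ p∣k   = ⊥-elim (ℕₚ.<⇒≱ k<p (ℕ∣.∣⇒≤ p∣k))

module _ where
  open Binomial ℤₚ.+-*-commutativeSemiring using (theorem; binomialTerm)
  open Algebra.Definitions.RawSemiring ℤ.+-*-rawSemiring
    using (sum) renaming (_×_ to _×ₛ_; _^_ to _^ₛ_)

  ×ₛ≡+* : ∀ n z → n ×ₛ z ≡ + n * z
  ×ₛ≡+* zero    z = sym (ℤₚ.*-zeroˡ z)
  ×ₛ≡+* (suc n) z = trans (cong (λ w → z + w) (×ₛ≡+* n z)) (sym (ℤₚ.suc-* (+ n) z))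

  ^ₛ≡^ : ∀ z n → z ^ₛ n ≡ z ^ℤ n
  ^ₛ≡^ z zero    = refl
  ^ₛ≡^ z (suc n) = cong (z *_) (^ₛ≡^ z n)

  sum≋last : ∀ {p m} (t : Vector ℤ (suc m)) → (∀ i → + p ∣ℤ t (Fin.inject₁ i)) →
             sum t ≋ t (Fin.fromℕ m) [mod p ]
  sum≋last {m = zero}  t _      = ≋-reflexive (ℤₚ.+-identityʳ (t zero))
  sum≋last {m = suc m} t p∣init =
    ≋-trans (+-cong-≋ (∣⇒≋0 (p∣init zero)) (sum≋last (Vec.tail t) (p∣init ∘ suc)))
            (≋-reflexive (ℤₚ.+-identityˡ _))

  freshman's-dream : ∀ {p} → Prime p → ∀ x y → (x + y) ^ℤ p ≋ x ^ℤ p + y ^ℤ p [mod p ]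
  freshman's-dream {p@(suc p′)} p-prime x y = begin
    (x + y) ^ℤ p                ≡⟨ trans (sym (^ₛ≡^ (x + y) p)) (theorem p x y) ⟩
    t zero + sum (Vec.tail t)   ≈⟨ +-cong-≋ (≋-refl {x = t zero}) (sum≋last (Vec.tail t) p∣middle) ⟩
    t zero + t (Fin.fromℕ p)    ≡⟨ cong₂ _+_ first last ⟩
    y ^ℤ p + x ^ℤ p             ≡⟨ ℤₚ.+-comm (y ^ℤ p) (x ^ℤ p) ⟩
    x ^ℤ p + y ^ℤ p             ∎
    where
      open ≋-Reasoning p
      t : Vector ℤ (suc p)
      t = binomialTerm x y p
      term : ∀ k i → toℕ i ≡ k → t i ≡ + (p C k) * (x ^ℤ k * y ^ℤ (p ∸ k))
      term k i refl =
        trans (×ₛ≡+* (p C k) _) (cong (λ e → + (p C k) * e) (cong₂ _*_ (^ₛ≡^ x k) (^ₛ≡^ y (p ∸ k))))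
      first : t zero ≡ y ^ℤ p
      first = trans (term 0 zero refl) (trans (ℤₚ.*-identityˡ _) (ℤₚ.*-identityˡ _))
      last : t (Fin.fromℕ p) ≡ x ^ℤ p
      last = trans (term p (Fin.fromℕ p) (Finₚ.toℕ-fromℕ p))
        (trans (cong₂ (λ c e → + c * (x ^ℤ p * y ^ℤ e)) (nCn≡1 p) (ℕₚ.n∸n≡0 p))
               (trans (ℤₚ.*-identityˡ _) (ℤₚ.*-identityʳ _)))
      p∣middle : ∀ i → + p ∣ℤ t (suc (Fin.inject₁ i))
      p∣middle i = ∣ℤ-respects (sym (term k (suc (Fin.inject₁ i)) refl))
        (∣m⇒∣m*n (x ^ℤ k * y ^ℤ (p ∸ k))
          (∣⇒∣ℤ (+ (p C k)) (prime∣pCk p-prime k (s≤s z≤n) (s≤s (Finₚ.inject₁ℕ< i)))))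
        where k : ℕ
              k = suc (toℕ (Fin.inject₁ i))

fermat-ℕ : ∀ {p} → Prime p → ∀ n → (+ n) ^ℤ p ≋ + n [mod p ]
fermat-ℕ {suc _} p-prime zero    = ≋-refl
fermat-ℕ {p}     p-prime (suc n) = begin
  (+ suc n) ^ℤ p              ≡⟨ cong (_^ℤ p) suc≡+1 ⟩
  (+ n + + 1) ^ℤ p            ≈⟨ freshman's-dream p-prime (+ n) (+ 1) ⟩
  (+ n) ^ℤ p + (+ 1) ^ℤ p     ≈⟨ +-cong-≋ (fermat-ℕ p-prime n) (≋-reflexive (ℤₚ.^-zeroˡ p)) ⟩
  + n + + 1                   ≡⟨ suc≡+1 ⟨
  + suc n                     ∎
  where
    open ≋-Reasoning p
    suc≡+1 : + suc n ≡ + n + + 1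
    suc≡+1 = cong +_ (ℕₚ.+-comm 1 n)

fermat : ∀ {p} → Prime p → ∀ x → x ^ℤ p ≋ x [mod p ]
fermat {p} p-prime x = begin
  x ^ℤ p                ≈⟨ ^-cong-≋ p (≋-%ℕ p x) ⟩
  (+ (x %ℕ p)) ^ℤ p     ≈⟨ fermat-ℕ p-prime (x %ℕ p) ⟩
  + (x %ℕ p)            ≈⟨ ≋-sym (≋-%ℕ p x) ⟩
  x                     ∎
  where
    open ≋-Reasoning p
    instance
      p≢0 : NonZero p
      p≢0 = prime⇒nonZero p-prime

fermat-unit : ∀ {p} → Prime p → ∀ x → ¬ + p ∣ℤ x → x ^ℤ (p ∸ 1) ≋ + 1 [mod p ]
fermat-unit {suc p′} p-prime x p∤x = mk≋ (prime∣*∧∤⇒∣ p-prime x (x ^ℤ p′ - + 1) p∣x[xᵖ⁻¹-1] p∤x)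
  where
    factor : ∀ x y → x * y - x ≡ x * (y - + 1)
    factor = solve-∀
    p∣x[xᵖ⁻¹-1] : + suc p′ ∣ℤ x * (x ^ℤ p′ - + 1)
    p∣x[xᵖ⁻¹-1] = ∣ℤ-respects (factor x (x ^ℤ p′)) (∣-difference (fermat p-prime x))

-- Polynomials modulo a prime

eval : List ℤ → ℤ → ℤ
eval []       x = + 0
eval (c ∷ cs) x = c + x * eval cs x

syntheticDivision : List ℤ → ℤ → List ℤ
syntheticDivision []                c = []
syntheticDivision (_ ∷ [])          c = []
syntheticDivision (_ ∷ cs@(_ ∷ _)) c = eval cs c ∷ syntheticDivision cs c

length-syntheticDivision : ∀ f c → length (syntheticDivision f c) ≡ length f ∸ 1
length-syntheticDivision []                c = refl
length-syntheticDivision (_ ∷ [])          c = refl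
length-syntheticDivision (_ ∷ cs@(_ ∷ _)) c = cong suc (length-syntheticDivision cs c)

eval-syntheticDivision : ∀ f c x → eval f x ≡ (x - c) * eval (syntheticDivision f c) x + eval f c
eval-syntheticDivision [] c x = zeros x c
  where zeros : ∀ x c → + 0 ≡ (x - c) * + 0 + + 0
        zeros = solve-∀
eval-syntheticDivision (a ∷ []) c x = constant a x c
  where constant : ∀ a x c → a + x * + 0 ≡ (x - c) * + 0 + (a + c * + 0)
        constant = solve-∀
eval-syntheticDivision (a ∷ cs@(_ ∷ _)) c x
  rewrite eval-syntheticDivision cs c x = horner a x c (eval cs c) (eval (syntheticDivision cs c) x)
  where horner : ∀ a x c r q → a + x * ((x - c) * q + r) ≡ (x - c) * (r + x * q) + (a + c * r)
        horner = solve-∀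

vanishes-on-1…k⇒vanishes : ∀ {p} → Prime p → ∀ k f → k < p → length f ≤ k →
  (∀ j → 0 < j → j ≤ k → eval f (+ j) ≋ + 0 [mod p ]) → ∀ x → eval f x ≋ + 0 [mod p ]
vanishes-on-1…k⇒vanishes p-prime zero    []      _   _      _     x = ≋-refl
vanishes-on-1…k⇒vanishes {p} p-prime (suc k) f k<p |f|≤k roots x = begin
  eval f x                        ≡⟨ eval-syntheticDivision f c x ⟩
  (x - c) * eval g x + eval f c   ≈⟨ +-cong-≋ (*-cong-≋ (≋-refl {x = x - c}) (g-vanishes x)) f[c]≋0 ⟩
  (x - c) * + 0 + + 0             ≡⟨ zero-sum (x - c) ⟩
  + 0                             ∎
  where
    open ≋-Reasoning p
    c : ℤ
    c = + suc k
    g : List ℤ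
    g = syntheticDivision f c
    zero-sum : ∀ y → y * + 0 + + 0 ≡ + 0
    zero-sum = solve-∀
    f[c]≋0 : eval f c ≋ + 0 [mod p ]
    f[c]≋0 = roots (suc k) (s≤s z≤n) ℕₚ.≤-refl
    |g|≤k : length g ≤ k
    |g|≤k = subst (_≤ k) (sym (length-syntheticDivision f c)) (ℕₚ.∸-monoˡ-≤ 1 |f|≤k)
    g-roots : ∀ j → 0 < j → j ≤ k → eval g (+ j) ≋ + 0 [mod p ]
    g-roots j 0<j j≤k =
      ∣⇒≋0 (prime∣*∧∤⇒∣ p-prime (+ j - c) (eval g (+ j)) p∣[j-c]g[j] (<⇒≉-mod (s≤s j≤k) k<p ∘ mk≋))
      where
        cancel : ∀ u v → u + v - v ≡ u
        cancel = solve-∀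
        p∣[j-c]g[j] : + p ∣ℤ (+ j - c) * eval g (+ j)
        p∣[j-c]g[j] =
          ∣ℤ-respects (trans (cong (_- eval f c) (eval-syntheticDivision f c (+ j))) (cancel _ _))
            (∣-difference (≋-trans (roots j 0<j (ℕₚ.m≤n⇒m≤1+n j≤k)) (≋-sym f[c]≋0)))
    g-vanishes : ∀ x → eval g x ≋ + 0 [mod p ]
    g-vanishes = vanishes-on-1…k⇒vanishes p-prime k g (ℕₚ.<-trans (ℕₚ.n<1+n k) k<p) |g|≤k g-roots

shiftBy : ℕ → List ℤ → List ℤ
shiftBy k f = replicate k (+ 0) ++ f

eval-shiftBy : ∀ k f x → eval (shiftBy k f) x ≡ x ^ℤ k * eval f x
eval-shiftBy zero    f x = sym (ℤₚ.*-identityˡ (eval f x))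
eval-shiftBy (suc k) f x rewrite eval-shiftBy k f x = regroup x (x ^ℤ k) (eval f x)
  where regroup : ∀ x y e → + 0 + x * (y * e) ≡ x * y * e
        regroup = solve-∀

length-shiftBy : ∀ k f → length (shiftBy k f) ≡ k ℕ.+ length f
length-shiftBy k f =
  trans (Listₚ.length-++ (replicate k (+ 0))) (cong (ℕ._+ length f) (Listₚ.length-replicate k))

xᵏ-1 : ℕ → List ℤ
xᵏ-1 zero    = []
xᵏ-1 (suc k) = - + 1 ∷ shiftBy k (+ 1 ∷ [])

eval-xᵏ-1 : ∀ k x → eval (xᵏ-1 k) x ≡ x ^ℤ k - + 1
eval-xᵏ-1 zero    x = refl
eval-xᵏ-1 (suc k) x rewrite eval-shiftBy k (+ 1 ∷ []) x = expand x (x ^ℤ k)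
  where expand : ∀ x y → - + 1 + x * (y * (+ 1 + x * + 0)) ≡ x * y - + 1
        expand = solve-∀

length-xᵏ-1 : ∀ k → length (xᵏ-1 k) ≤ suc k
length-xᵏ-1 zero    = z≤n
length-xᵏ-1 (suc k) = s≤s (ℕₚ.≤-reflexive (trans (length-shiftBy k (+ 1 ∷ [])) (ℕₚ.+-comm k 1)))

spread : ℕ → List ℤ → List ℤ
spread k []       = []
spread k (c ∷ cs) = c ∷ shiftBy k (spread k cs)

eval-spread : ∀ k f x → eval (spread k f) x ≡ eval f (x ^ℤ suc k)
eval-spread k []       x = refl
eval-spread k (c ∷ cs) x rewrite eval-shiftBy k (spread k cs) x | eval-spread k cs x =
  cong (λ e → c + e) (sym (ℤₚ.*-assoc x (x ^ℤ k) (eval cs (x ^ℤ suc k))))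

length-spread : ∀ k f → length (spread k f) ≡ length f ℕ.* suc k
length-spread k []       = refl
length-spread k (c ∷ cs) =
  cong suc (trans (length-shiftBy k (spread k cs)) (cong (k ℕ.+_) (length-spread k cs)))

geometric : ℤ → ℕ → List ℤ
geometric a zero    = []
geometric a (suc m) = a ^ℤ m ∷ geometric a m

length-geometric : ∀ a m → length (geometric a m) ≡ m
length-geometric a zero    = refl
length-geometric a (suc m) = cong suc (length-geometric a m)

eval-geometric : ∀ a m y → (y - a) * eval (geometric a m) y ≡ y ^ℤ m - a ^ℤ m
eval-geometric a zero    y = cancel y a
  where cancel : ∀ y a → (y - a) * + 0 ≡ + 1 - + 1
        cancel = solve-∀
eval-geometric a (suc m) y = begin
  (y - a) * (a ^ℤ m + y * g)                ≡⟨ distrib y a (a ^ℤ m) g ⟩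
  (y - a) * a ^ℤ m + y * ((y - a) * g)      ≡⟨ cong (λ e → (y - a) * a ^ℤ m + y * e) (eval-geometric a m y) ⟩
  (y - a) * a ^ℤ m + y * (y ^ℤ m - a ^ℤ m)  ≡⟨ telescope y a (a ^ℤ m) (y ^ℤ m) ⟩
  y * y ^ℤ m - a * a ^ℤ m                   ∎
  where
    open ≡.≡-Reasoning
    g : ℤ
    g = eval (geometric a m) y
    distrib : ∀ y a A g → (y - a) * (A + y * g) ≡ (y - a) * A + y * ((y - a) * g)
    distrib = solve-∀
    telescope : ∀ y a A Y → (y - a) * A + y * (Y - A) ≡ y * Y - a * A
    telescope = solve-∀

unit-exponent-≥ : ∀ {p} → Prime p → ∀ r → 0 < r →
  (∀ x → ¬ + p ∣ℤ x → x ^ℤ r ≋ + 1 [mod p ]) → p ∸ 1 ≤ r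
unit-exponent-≥ {p} p-prime r@(suc _) _ xʳ≋1 with p ∸ 1 ℕ.≤? r
... | yes p-1≤r = p-1≤r
... | no  p-1≰r = ⊥-elim (¬∣ℤ-small {p} {1} (s≤s z≤n) (prime>1 p-prime) (ℤ∣.∣m⇒∣-m p∣-1))
  where
    roots : ∀ j → 0 < j → j ≤ p ∸ 1 → eval (xᵏ-1 r) (+ j) ≋ + 0 [mod p ]
    roots j 0<j j≤p-1 = begin
      eval (xᵏ-1 r) (+ j)   ≡⟨ eval-xᵏ-1 r (+ j) ⟩
      (+ j) ^ℤ r - + 1      ≈⟨ +-cong-≋ (xʳ≋1 (+ j) (¬∣ℤ-small 0<j (≤∸1⇒< (prime>0 p-prime) j≤p-1)))
                                         (≋-refl {x = - + 1}) ⟩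
      + 0                   ∎
      where open ≋-Reasoning p
    p∣-1 : + p ∣ℤ - + 1
    p∣-1 = ≋0⇒∣ (subst (_≋ + 0 [mod p ]) (eval-xᵏ-1 r (+ 0))
             (vanishes-on-1…k⇒vanishes p-prime (p ∸ 1) (xᵏ-1 r) (≤∸1⇒< (prime>0 p-prime) ℕₚ.≤-refl)
               (ℕₚ.≤-trans (length-xᵏ-1 r) (ℕₚ.≰⇒> p-1≰r)) roots (+ 0)))

unit-exponent-∣ : ∀ {p} → Prime p → ∀ L → (∀ x → ¬ + p ∣ℤ x → x ^ℤ L ≋ + 1 [mod p ]) → p ∸ 1 ∣ L
unit-exponent-∣ {p} p-prime L xᴸ≋1 = ℕ∣.m%n≡0⇒n∣m L (p ∸ 1) r≡0
  where
    instance
      p-1≢0 : NonZero (p ∸ 1)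
      p-1≢0 = ℕ.>-nonZero (ℕₚ.m<n⇒0<n∸m (prime>1 p-prime))
    r : ℕ
    r = L % (p ∸ 1)
    xʳ≋1 : ∀ x → ¬ + p ∣ℤ x → x ^ℤ r ≋ + 1 [mod p ]
    xʳ≋1 x p∤x = ^≋1-+ x r ((L / (p ∸ 1)) ℕ.* (p ∸ 1)) (sym (m≡m%n+[m/n]*n L (p ∸ 1))) (xᴸ≋1 x p∤x)
                   (^≋1-∣ x (ℕ∣.n∣m*n (L / (p ∸ 1))) (fermat-unit p-prime x p∤x))
    r≡0 : r ≡ 0
    r≡0 = ℕₚ.n≤0⇒n≡0 (ℕₚ.≮⇒≥ λ 0<r → ℕₚ.<⇒≱ (m%n<n L (p ∸ 1)) (unit-exponent-≥ p-prime r 0<r xʳ≋1))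

-- If a is not a q-th power, every unit x is a root of
-- (x^(qm) - a^m)/(x^q - a), whose p - 1 coefficients then all vanish,
-- among them the constant term a^(m-1).
euler-criterion : ∀ {p} → Prime p → ∀ q m → q ℕ.* m ≡ p ∸ 1 → ∀ a → ¬ + p ∣ℤ a →
                  a ^ℤ m ≋ + 1 [mod p ] → IsPowerMod q p a
euler-criterion p-prime zero m 0≡p-1 _ _ _ =
  ⊥-elim (ℕₚ.<⇒≢ (ℕₚ.m<n⇒0<n∸m (prime>1 p-prime)) 0≡p-1)
euler-criterion p-prime (suc q′) zero q0≡p-1 _ _ _ =
  ⊥-elim (ℕₚ.<⇒≢ (ℕₚ.m<n⇒0<n∸m (prime>1 p-prime)) (trans (sym (ℕₚ.*-zeroʳ q′)) q0≡p-1))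
euler-criterion {p} p-prime q@(suc q′) m@(suc m′) qm≡p-1 a p∤a aᵐ≋1
  with IsPowerMod-dec q p {{prime⇒nonZero p-prime}} a
... | yes a-power = a-power
... | no  ¬power  = ⊥-elim (p∤a (prime∣^⇒∣ p-prime a m′ p∣aᵐ⁻¹))
  where
    G : List ℤ
    G = spread q′ (geometric a m)
    |G|≤p-1 : length G ≤ p ∸ 1
    |G|≤p-1 = ℕₚ.≤-reflexive (begin
      length G                         ≡⟨ length-spread q′ (geometric a m) ⟩
      length (geometric a m) ℕ.* q     ≡⟨ cong (ℕ._* q) (length-geometric a m) ⟩
      m ℕ.* q                          ≡⟨ ℕₚ.*-comm m q ⟩
      q ℕ.* m                          ≡⟨ qm≡p-1 ⟩
      p ∸ 1                            ∎)
      where open ≡.≡-Reasoning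
    roots : ∀ j → 0 < j → j ≤ p ∸ 1 → eval G (+ j) ≋ + 0 [mod p ]
    roots j 0<j j≤p-1 = subst (_≋ + 0 [mod p ]) (sym (eval-spread q′ (geometric a m) (+ j)))
      (∣⇒≋0 (prime∣*∧∤⇒∣ p-prime (y - a) (eval (geometric a m) y) p∣[y-a]g[y] p∤y-a))
      where
        y : ℤ
        y = (+ j) ^ℤ q
        yᵐ≋1 : y ^ℤ m ≋ + 1 [mod p ]
        yᵐ≋1 = subst (_≋ + 1 [mod p ]) (trans (cong ((+ j) ^ℤ_) (sym qm≡p-1)) (sym (ℤₚ.^-*-assoc (+ j) q m)))
                 (fermat-unit p-prime (+ j) (¬∣ℤ-small 0<j (≤∸1⇒< (prime>0 p-prime) j≤p-1)))
        p∣[y-a]g[y] : + p ∣ℤ (y - a) * eval (geometric a m) y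
        p∣[y-a]g[y] = ∣ℤ-respects (sym (eval-geometric a m y)) (∣-difference (≋-trans yᵐ≋1 (≋-sym aᵐ≋1)))
        p∤y-a : ¬ + p ∣ℤ y - a
        p∤y-a p∣y-a = ¬power (+ j , ≋⇒≡-mod (≋-sym {x = y} (mk≋ p∣y-a)))
    p∣aᵐ⁻¹ : + p ∣ℤ a ^ℤ m′
    p∣aᵐ⁻¹ = ≋0⇒∣ (subst (_≋ + 0 [mod p ]) (ℤₚ.+-identityʳ (a ^ℤ m′))
      (vanishes-on-1…k⇒vanishes p-prime (p ∸ 1) G (≤∸1⇒< (prime>0 p-prime) ℕₚ.≤-refl) |G|≤p-1 roots (+ 0)))

-- Valuations and divisibility

^-monoʳ-∣ : ∀ q {m n} → m ≤ n → q ^ m ∣ q ^ n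
^-monoʳ-∣ q {m} {n} m≤n = divides (q ^ (n ∸ m)) (begin
  q ^ n                    ≡⟨ cong (q ^_) (ℕₚ.m+[n∸m]≡n m≤n) ⟨
  q ^ (m ℕ.+ (n ∸ m))      ≡⟨ ℕₚ.^-distribˡ-+-* q m (n ∸ m) ⟩
  q ^ m ℕ.* q ^ (n ∸ m)    ≡⟨ ℕₚ.*-comm (q ^ m) _ ⟩
  q ^ (n ∸ m) ℕ.* q ^ m    ∎)
  where open ≡.≡-Reasoning

valuation-unique : ∀ {q m v w} → IsValuation q m v → IsValuation q m w → v ≡ w
valuation-unique {q} {m} {v} {w} (qᵛ∣m , qᵛ⁺¹∤m) (qʷ∣m , qʷ⁺¹∤m) with ℕₚ.<-cmp v w
... | tri< v<w _ _ = ⊥-elim (qᵛ⁺¹∤m (∣-trans (^-monoʳ-∣ q v<w) qʷ∣m))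
... | tri≈ _ v≡w _ = v≡w
... | tri> _ _ w<v = ⊥-elim (qʷ⁺¹∤m (∣-trans (^-monoʳ-∣ q w<v) qᵛ∣m))

valuation-dec : ∀ q m v → Dec (IsValuation q m v)
valuation-dec q m v = (q ^ v ∣? m) ×-dec ¬? (q ^ suc v ∣? m)

valuation-*q : ∀ {q m} v → Prime q → IsValuation q m v → IsValuation q (m ℕ.* q) (suc v)
valuation-*q {q} {m} v q-prime (qᵛ∣m , qᵛ⁺¹∤m) =
  subst (_∣ m ℕ.* q) (ℕₚ.*-comm (q ^ v) q) (ℕ∣.*-monoˡ-∣ q qᵛ∣m) ,
  λ qᵛ⁺²∣mq → qᵛ⁺¹∤m (ℕ∣.*-cancelʳ-∣ q {{prime⇒nonZero q-prime}}
                        (subst (_∣ m ℕ.* q) (ℕₚ.*-comm q (q ^ suc v)) qᵛ⁺²∣mq))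

valuation-exists : ∀ {q} → Prime q → ∀ m → 0 < m → ∃ (IsValuation q m)
valuation-exists {q} q-prime = <-rec _ step
  where
    step : ∀ m → (∀ {m′} → m′ < m → 0 < m′ → ∃ (IsValuation q m′)) → 0 < m → ∃ (IsValuation q m)
    step m rec 0<m with q ∣? m
    ... | no  q∤m = 0 , ℕ∣.1∣ m , q∤m ∘ subst (_∣ m) (ℕₚ.*-identityʳ q)
    ... | yes (divides m′ refl) =
      let m′≢0 = ℕₚ.m*n≢0⇒m≢0 m′ {{ℕ.>-nonZero 0<m}}
          v , val = rec (ℕₚ.m<m*n m′ q {{m′≢0}} (prime>1 q-prime)) (ℕ.>-nonZero⁻¹ m′ {{m′≢0}})
      in suc v , valuation-*q v q-prime val

prime∤⇒coprime : ∀ {q d} → Prime q → ¬ q ∣ d → Coprime d q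
prime∤⇒coprime q-prime q∤d {e} (e∣d , e∣q) with prime⇒irreducible q-prime e∣q
... | inj₁ e≡1 = e≡1
... | inj₂ refl = ⊥-elim (q∤d e∣d)

∣q*m⇒∣m : ∀ {q} → Prime q → ∀ w {d m} → d ∣ q ℕ.* m → q ^ w ∣ m → ¬ q ^ suc w ∣ d → d ∣ m
∣q*m⇒∣m {q} q-prime w {d} d∣qm qʷ∣m qʷ⁺¹∤d with q ∣? d
... | no q∤d = coprime-divisor (prime∤⇒coprime q-prime q∤d) d∣qm
∣q*m⇒∣m {q} q-prime zero {d} d∣qm qʷ∣m qʷ⁺¹∤d | yes q∣d =
  ⊥-elim (qʷ⁺¹∤d (subst (_∣ d) (sym (ℕₚ.*-identityʳ q)) q∣d))
∣q*m⇒∣m {q} q-prime (suc w) d∣qm (divides k refl) qʷ⁺¹∤d | yes (divides d′ refl) =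
  subst (d′ ℕ.* q ∣_) (sym m≡m′q) (ℕ∣.*-monoˡ-∣ q d′∣m′)
  where
    instance
      q≢0 : NonZero q
      q≢0 = prime⇒nonZero q-prime
    m′ : ℕ
    m′ = k ℕ.* q ^ w
    m≡m′q : k ℕ.* q ^ suc w ≡ m′ ℕ.* q
    m≡m′q = x∙yz≈xz∙y k q (q ^ w)
    d′∣qm′ : d′ ∣ q ℕ.* m′
    d′∣qm′ = ℕ∣.*-cancelʳ-∣ q
      (subst (d′ ℕ.* q ∣_) (trans (cong (q ℕ.*_) m≡m′q) (sym (ℕₚ.*-assoc q m′ q))) d∣qm)
    d′∣m′ : d′ ∣ m′
    d′∣m′ = ∣q*m⇒∣m q-prime w d′∣qm′ (ℕ∣.n∣m*n k) λ qʷ⁺¹∣d′ →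
      qʷ⁺¹∤d (subst (_∣ d′ ℕ.* q) (ℕₚ.*-comm (q ^ suc w) q) (ℕ∣.*-monoˡ-∣ q qʷ⁺¹∣d′))

prime-factor : ∀ {n} → 1 < n → ∃ λ q → Prime q × q ∣ n
prime-factor {n} 1<n = first-factor factors isFactorisation factorsPrime
  where
    open PrimeFactorisation (factorise n {{ℕ.>-nonZero (ℕₚ.<-trans (s≤s z≤n) 1<n)}})
    first-factor : ∀ qs → n ≡ product qs → All Prime qs → ∃ λ q → Prime q × q ∣ n
    first-factor []       n≡1  _             = ⊥-elim (ℕₚ.<⇒≢ 1<n (sym n≡1))
    first-factor (q ∷ qs) n≡qΠ (q-prime ∷ _) =
      q , q-prime , divides (product qs) (trans n≡qΠ (ℕₚ.*-comm q _))

∣∧<⇒∣-maximal : ∀ {d n} → d ∣ n → d < n → ∃ λ q → Prime q × ∃ λ n′ → n ≡ n′ ℕ.* q × d ∣ n′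
∣∧<⇒∣-maximal {d} {n} d∣n d<n with prime-factor (ℕ∣.quotient>1 d∣n d<n)
... | q , q-prime , divides k′ k≡k′q = q , q-prime , k′ ℕ.* d , n≡k′dq , ℕ∣.n∣m*n k′
  where
    n≡k′dq : n ≡ k′ ℕ.* d ℕ.* q
    n≡k′dq = trans (ℕ∣.m∣n⇒n≡quotient*m d∣n) (trans (cong (ℕ._* d) k≡k′q) (xy∙z≈xz∙y k′ q d))

module _ {q : ℕ} (q-prime : Prime q) where

  ∣*q∧¬valuation⇒∣ : ∀ w {d L′} → d ∣ L′ ℕ.* q → IsValuation q L′ w → ¬ IsValuation q d (suc w) →
                     d ∣ L′
  ∣*q∧¬valuation⇒∣ w {d} {L′} d∣L′q (qʷ∣L′ , qʷ⁺¹∤L′) ¬val =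
    ∣q*m⇒∣m q-prime w (subst (d ∣_) (ℕₚ.*-comm L′ q) d∣L′q) qʷ∣L′ λ qʷ⁺¹∣d → ¬val (qʷ⁺¹∣d , qʷ⁺²∤d)
    where
      qʷ⁺²∤d : ¬ q ^ suc (suc w) ∣ d
      qʷ⁺²∤d qʷ⁺²∣d = qʷ⁺¹∤L′ (ℕ∣.*-cancelʳ-∣ q {{prime⇒nonZero q-prime}}
        (subst (_∣ L′ ℕ.* q) (ℕₚ.*-comm q (q ^ suc w)) (∣-trans qʷ⁺²∣d d∣L′q)))

  gcd∣cofactor : ∀ w {L′ M} → IsValuation q L′ w → IsValuation q (q ℕ.* M) (suc w) →
                 gcd L′ (q ℕ.* M) ∣ M
  gcd∣cofactor w {L′} {M} (_ , qʷ⁺¹∤L′) (qʷ⁺¹∣qM , _) =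
    ∣q*m⇒∣m q-prime w (gcd[m,n]∣n L′ (q ℕ.* M)) (ℕ∣.*-cancelˡ-∣ q {{prime⇒nonZero q-prime}} qʷ⁺¹∣qM)
      (qʷ⁺¹∤L′ ∘ flip ∣-trans (gcd[m,n]∣m L′ (q ℕ.* M)))

-- Squarefree moduli

prime∣prime⇒≡ : ∀ {p r} → Prime p → Prime r → p ∣ r → p ≡ r
prime∣prime⇒≡ p-prime r-prime p∣r with prime⇒irreducible r-prime p∣r
... | inj₁ p≡1 = ⊥-elim (ℕₚ.<⇒≢ (prime>1 p-prime) (sym p≡1))
... | inj₂ p≡r = p≡r

prime∣∧∣∧∤⇒*∣ : ∀ {p m z} → Prime p → p ∣ z → m ∣ z → ¬ p ∣ m → p ℕ.* m ∣ z
prime∣∧∣∧∤⇒*∣ {p} {m} p-prime p∣z (divides t refl) p∤m with euclidsLemma t m p-prime p∣z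
... | inj₁ p∣t = ℕ∣.*-monoˡ-∣ m p∣t
... | inj₂ p∣m = ⊥-elim (p∤m p∣m)

∣prodFin : ∀ {ℓ} (ps : Fin ℓ → ℕ) i → ps i ∣ prodFin ps
∣prodFin ps zero    = ℕ∣.m∣m*n _
∣prodFin ps (suc i) = ∣-trans (∣prodFin (ps ∘ suc) i) (ℕ∣.n∣m*n (ps zero))

prime∤prodFin : ∀ {p ℓ} → Prime p → (qs : Fin ℓ → ℕ) → (∀ j → ¬ p ∣ qs j) → ¬ p ∣ prodFin qs
prime∤prodFin {ℓ = zero}  p-prime qs _    p∣1 = ℕₚ.<⇒≢ (prime>1 p-prime) (sym (ℕ∣.∣1⇒≡1 p∣1))
prime∤prodFin {ℓ = suc ℓ} p-prime qs p∤qs p∣Π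
  with euclidsLemma (qs zero) (prodFin (qs ∘ suc)) p-prime p∣Π
... | inj₁ p∣q₀ = p∤qs zero p∣q₀
... | inj₂ p∣Π′ = prime∤prodFin p-prime (qs ∘ suc) (p∤qs ∘ suc) p∣Π′

module _ {ℓ} (ps : Fin (suc ℓ) → ℕ) (ps-prime : ∀ i → Prime (ps i))
         (ps-injective : ∀ i j → ps i ≡ ps j → i ≡ j) where

  tail-injective : ∀ i j → ps (suc i) ≡ ps (suc j) → i ≡ j
  tail-injective i j e = Finₚ.suc-injective (ps-injective (suc i) (suc j) e)

  head∤prodFin-tail : ¬ ps zero ∣ prodFin (ps ∘ suc)
  head∤prodFin-tail = prime∤prodFin (ps-prime zero) (ps ∘ suc) λ j p₀∣pⱼ →
    Finₚ.0≢1+n (ps-injective zero (suc j) (prime∣prime⇒≡ (ps-prime zero) (ps-prime (suc j)) p₀∣pⱼ))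

∣⇒prodFin∣ : ∀ {ℓ} (ps : Fin ℓ → ℕ) → (∀ i → Prime (ps i)) → (∀ i j → ps i ≡ ps j → i ≡ j) →
             ∀ {z} → (∀ i → ps i ∣ z) → prodFin ps ∣ z
∣⇒prodFin∣ {zero}  ps _        _            _     = ℕ∣.1∣ _
∣⇒prodFin∣ {suc ℓ} ps ps-prime ps-injective ps∣z =
  prime∣∧∣∧∤⇒*∣ (ps-prime zero) (ps∣z zero)
    (∣⇒prodFin∣ (ps ∘ suc) (ps-prime ∘ suc) (tail-injective ps ps-prime ps-injective) (ps∣z ∘ suc))
    (head∤prodFin-tail ps ps-prime ps-injective)

prodFin-split : ∀ {ℓ} (ps : Fin ℓ → ℕ) → (∀ i → Prime (ps i)) → (∀ i j → ps i ≡ ps j → i ≡ j) →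
                ∀ i → ∃ λ m → prodFin ps ≡ ps i ℕ.* m × ¬ ps i ∣ m
prodFin-split ps ps-prime ps-injective zero =
  prodFin (ps ∘ suc) , refl , head∤prodFin-tail ps ps-prime ps-injective
prodFin-split ps ps-prime ps-injective (suc i)
  with prodFin-split (ps ∘ suc) (ps-prime ∘ suc) (tail-injective ps ps-prime ps-injective) i
... | m , Π′≡pᵢm , pᵢ∤m =
  ps zero ℕ.* m , trans (cong (ps zero ℕ.*_) Π′≡pᵢm) (x∙yz≈y∙xz (ps zero) (ps (suc i)) m) ,
  [ pᵢ∤p₀ , pᵢ∤m ]′ ∘ euclidsLemma (ps zero) m (ps-prime (suc i))
  where
    pᵢ∤p₀ : ¬ ps (suc i) ∣ ps zero
    pᵢ∤p₀ pᵢ∣p₀ = Finₚ.0≢1+n (sym (ps-injective (suc i) zero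
      (prime∣prime⇒≡ (ps-prime (suc i)) (ps-prime zero) pᵢ∣p₀)))

≋1⇒coprime : ∀ {m y} → y ≋ + 1 [mod m ] → Coprime ∣ y ∣ m
≋1⇒coprime {m} {y} (mk≋ m∣y-1) (e∣y , e∣m) = ℕ∣.∣1⇒≡1 (∣ℤ⇒∣ (∣ℤ-respects (cancel y)
  (ℤ∣.∣m∣n⇒∣m-n (∣⇒∣ℤ y e∣y) (ℤ∣.∣-trans (∣⇒∣ℤ (+ m) e∣m) m∣y-1))))
  where cancel : ∀ y → y - (y - + 1) ≡ + 1
        cancel = solve-∀

coprime⇒coprime-prime* : ∀ {p m a} → Prime p → ¬ p ∣ a → Coprime a m → Coprime a (p ℕ.* m)
coprime⇒coprime-prime* {p} {m} {a} p-prime p∤a a⊥m {d} (d∣a , d∣pm) =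
  [ id , (λ d≡p → ⊥-elim (p∤a (subst (_∣ a) d≡p d∣a))) ]′ (prime⇒irreducible p-prime d∣p)
  where
    d⊥m : Coprime d m
    d⊥m (e∣d , e∣m) = a⊥m (∣-trans e∣d d∣a , e∣m)
    d∣p : d ∣ p
    d∣p = coprime-divisor d⊥m (subst (d ∣_) (ℕₚ.*-comm p m) d∣pm)

unit-lift : ∀ {p} → Prime p → ∀ m → ¬ p ∣ m → ∀ x → ¬ + p ∣ℤ x →
            ∃ λ x′ → x′ ≋ x [mod p ] × CoprimeZ x′ (p ℕ.* m)
unit-lift {p} p-prime m p∤m x p∤x =
  x′ , x′≋x , coprime⇒coprime-prime* p-prime (p∤x ∘ ∣-respects-≋ (≋-sym x′≋x) ∘ ∣⇒∣ℤ x′) (≋1⇒coprime x′≋1)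
  where
    e x′ : ℤ
    e = (+ m) ^ℤ (p ∸ 1)
    x′ = + 1 + (x - + 1) * e
    cancel : ∀ x → + 1 + (x - + 1) * + 1 ≡ x
    cancel = solve-∀
    x′≋x : x′ ≋ x [mod p ]
    x′≋x = ≋-trans (+-cong-≋ (≋-refl {x = + 1}) (*-cong-≋ (≋-refl {x = x - + 1})
                     (fermat-unit p-prime (+ m) (p∤m ∘ ∣ℤ⇒∣))))
                   (≋-reflexive (cancel x))
    m∣e : + m ∣ℤ e
    m∣e = ∣⇒∣^ (p ∸ 1) (ℕₚ.m<n⇒0<n∸m (prime>1 p-prime)) ℤ∣.∣-refl
    x′-1≡ : ∀ x e → (x - + 1) * e ≡ + 1 + (x - + 1) * e - + 1
    x′-1≡ = solve-∀
    x′≋1 : x′ ≋ + 1 [mod m ]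
    x′≋1 = mk≋ (∣ℤ-respects (x′-1≡ x e) (∣n⇒∣m*n (x - + 1) m∣e))

unit-exponent-∣-* : ∀ {p} → Prime p → ∀ m → ¬ p ∣ m → ∀ L →
  (∀ b → CoprimeZ b (p ℕ.* m) → (b ^ℤ L) ≡ + 1 [mod p ℕ.* m ]) → p ∸ 1 ∣ L
unit-exponent-∣-* {p} p-prime m p∤m L bᴸ≡1 = unit-exponent-∣ p-prime L xᴸ≋1
  where
    xᴸ≋1 : ∀ x → ¬ + p ∣ℤ x → x ^ℤ L ≋ + 1 [mod p ]
    xᴸ≋1 x p∤x =
      let x′ , x′≋x , x′⊥pm = unit-lift p-prime m p∤m x p∤x in
      ≋-trans (^-cong-≋ L (≋-sym x′≋x)) (≋-weaken (ℕ∣.m∣m*n m) (≡-mod⇒≋ (bᴸ≡1 x′ x′⊥pm)))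

module _ {ℓ} (ps : Fin ℓ → ℕ) (ps-prime : ∀ i → Prime (ps i))
         (ps-injective : ∀ i j → ps i ≡ ps j → i ≡ j) where

  ≋1-mod-prodFin⇔ : ∀ z → z ≋ + 1 [mod prodFin ps ] ⇔ (∀ i → z ≋ + 1 [mod ps i ])
  ≋1-mod-prodFin⇔ z = mk⇔ (λ z≋1 i → ≋-weaken (∣prodFin ps i) z≋1)
    (λ z≋1 → mk≋ (∣⇒∣ℤ (z - + 1) (∣⇒prodFin∣ ps ps-prime ps-injective (∣ℤ⇒∣ ∘ ∣-difference ∘ z≋1))))

  ps∸1∣exponent : ∀ L → (∀ b → CoprimeZ b (prodFin ps) → (b ^ℤ L) ≡ + 1 [mod prodFin ps ]) →
                  ∀ i → ps i ∸ 1 ∣ L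
  ps∸1∣exponent L bᴸ≡1 i =
    let m , Π≡pᵢm , pᵢ∤m = prodFin-split ps ps-prime ps-injective i
    in unit-exponent-∣-* (ps-prime i) m pᵢ∤m L
         (subst (λ n → ∀ b → CoprimeZ b n → (b ^ℤ L) ≡ + 1 [mod n ]) Π≡pᵢm bᴸ≡1)

module _ {p q : ℕ} (p-prime : Prime p) (q-prime : Prime q) {a : ℤ} (p∤a : ¬ + p ∣ℤ a) where

  power⇒^≋1 : ∀ L′ → p ∸ 1 ∣ L′ ℕ.* q → IsPowerMod q p a → a ^ℤ L′ ≋ + 1 [mod p ]
  power⇒^≋1 L′ p-1∣L′q (x , a≡xᵠ) = begin
    a ^ℤ L′              ≈⟨ ^-cong-≋ L′ (≡-mod⇒≋ a≡xᵠ) ⟩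
    (x ^ℤ q) ^ℤ L′       ≡⟨ ℤₚ.^-*-assoc x q L′ ⟩
    x ^ℤ (q ℕ.* L′)      ≈⟨ ^≋1-∣ x (subst (p ∸ 1 ∣_) (ℕₚ.*-comm L′ q) p-1∣L′q) (fermat-unit p-prime x p∤x) ⟩
    + 1                  ∎
    where
      open ≋-Reasoning p
      p∤x : ¬ + p ∣ℤ x
      p∤x p∣x = p∤a (∣-respects-≋ (≡-mod⇒≋ a≡xᵠ) (∣⇒∣^ q (prime>0 q-prime) p∣x))

  ^≋1⇒power : ∀ {L′} w → IsValuation q L′ w → IsValuation q (p ∸ 1) (suc w) →
              a ^ℤ L′ ≋ + 1 [mod p ] → IsPowerMod q p a
  ^≋1⇒power {L′} w val-L′ val-p-1 aᴸ′≋1 with ∣-trans (ℕ∣.m∣m*n (q ^ w)) (proj₁ val-p-1)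
  ... | divides M p-1≡Mq = euler-criterion p-prime q M (sym p-1≡qM) a p∤a (^≋1-∣ a gcd∣M aᵍᶜᵈ≋1)
    where
      p-1≡qM : p ∸ 1 ≡ q ℕ.* M
      p-1≡qM = trans p-1≡Mq (ℕₚ.*-comm M q)
      gcd∣M : gcd L′ (q ℕ.* M) ∣ M
      gcd∣M = gcd∣cofactor q-prime w val-L′ (subst (λ d → IsValuation q d (suc w)) p-1≡qM val-p-1)
      aᵍᶜᵈ≋1 : a ^ℤ gcd L′ (q ℕ.* M) ≋ + 1 [mod p ]
      aᵍᶜᵈ≋1 = ^≋1-gcd a L′ (q ℕ.* M) aᴸ′≋1
                 (subst (λ e → a ^ℤ e ≋ + 1 [mod p ]) p-1≡qM (fermat-unit p-prime a p∤a))

  ^≋1-unless-nonpower : ∀ {L′} w → p ∸ 1 ∣ L′ ℕ.* q → IsValuation q L′ w →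
    (IsValuation q (p ∸ 1) (suc w) → IsPowerMod q p a) → a ^ℤ L′ ≋ + 1 [mod p ]
  ^≋1-unless-nonpower {L′} w p-1∣L′q val-L′ power with valuation-dec q (p ∸ 1) (suc w)
  ... | yes val-p-1 = power⇒^≋1 L′ p-1∣L′q (power val-p-1)
  ... | no ¬val-p-1 = ^≋1-∣ a (∣*q∧¬valuation⇒∣ q-prime w p-1∣L′q val-L′ ¬val-p-1) (fermat-unit p-prime a p∤a)

OrderTest : ℕ → ℤ → ℕ → Set
OrderTest n a L = ∀ q L′ → Prime q → L ≡ L′ ℕ.* q → ¬ a ^ℤ L′ ≋ + 1 [mod n ]

order-test : ∀ {n} (a : ℤ) {L} → 0 < L → (a ^ℤ L) ≡ + 1 [mod n ] → IsOrder n a L ⇔ OrderTest n a L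
order-test {n} a {L} 0<L aᴸ≡1 = mk⇔ no-smaller-exponent (λ test → 0<L , aᴸ≡1 , minimal test)
  where
    no-smaller-exponent : IsOrder n a L → OrderTest n a L
    no-smaller-exponent (_ , _ , minimal) q L′ q-prime refl aᴸ′≋1 =
      ℕₚ.<⇒≱ (ℕₚ.m<m*n L′ q {{L′≢0}} (prime>1 q-prime))
             (minimal L′ (ℕ.>-nonZero⁻¹ L′ {{L′≢0}}) (≋⇒≡-mod aᴸ′≋1))
      where L′≢0 : NonZero L′
            L′≢0 = ℕₚ.m*n≢0⇒m≢0 L′ {{ℕ.>-nonZero 0<L}}
    minimal : OrderTest n a L → ∀ j → 0 < j → (a ^ℤ j) ≡ + 1 [mod n ] → L ≤ j
    minimal test j 0<j aʲ≡1 = ℕ∣.∣⇒≤ {{ℕ.>-nonZero 0<j}} (decidable-stable (L ∣? j) L∤j⇒⊥)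
      where
        L∤j⇒⊥ : ¬ L ∣ j → ⊥
        L∤j⇒⊥ L∤j =
          let g<L = ℕₚ.≤∧≢⇒< (ℕ∣.∣⇒≤ {{ℕ.>-nonZero 0<L}} (gcd[m,n]∣n j L))
                              (λ g≡L → L∤j (subst (_∣ j) g≡L (gcd[m,n]∣m j L)))
              q , q-prime , L′ , L≡L′q , g∣L′ = ∣∧<⇒∣-maximal (gcd[m,n]∣n j L) g<L
          in test q L′ q-prime L≡L′q (^≋1-∣ a g∣L′ (^≋1-gcd a j L (≡-mod⇒≋ aʲ≡1) (≡-mod⇒≋ aᴸ≡1)))

module _ {ℓ} (ps : Fin ℓ → ℕ) (ps-prime : ∀ i → Prime (ps i))
         (ps-injective : ∀ i j → ps i ≡ ps j → i ≡ j)
         (a : ℤ) (a⊥Π : CoprimeZ a (prodFin ps)) {L : ℕ} (ps∸1∣L : ∀ i → ps i ∸ 1 ∣ L)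
         {q : ℕ} (L′ : ℕ) (q-prime : Prime q) (L≡L′q : L ≡ L′ ℕ.* q) where

  pᵢ∤a : ∀ i → ¬ + ps i ∣ℤ a
  pᵢ∤a i = coprime⇒prime∤ (ps-prime i) a (∣prodFin ps i) a⊥Π

  ^≋1⇔powers : ∀ w → IsValuation q L′ w →
    a ^ℤ L′ ≋ + 1 [mod prodFin ps ] ⇔ (∀ i → IsValuation q (ps i ∸ 1) (suc w) → IsPowerMod q (ps i) a)
  ^≋1⇔powers w val-L′ = mk⇔
    (λ aᴸ′≋1 i val-pᵢ → ^≋1⇒power (ps-prime i) q-prime (pᵢ∤a i) w val-L′ val-pᵢ
                          (Equivalence.to (≋1-mod-prodFin⇔ ps ps-prime ps-injective _) aᴸ′≋1 i))
    (λ powers → Equivalence.from (≋1-mod-prodFin⇔ ps ps-prime ps-injective _) λ i →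
      ^≋1-unless-nonpower (ps-prime i) q-prime (pᵢ∤a i) w (subst (ps i ∸ 1 ∣_) L≡L′q (ps∸1∣L i))
        val-L′ (powers i))

  nonpower-in-M⇔≉1 : 0 < L →
    (∃ λ p → InM q L ps p × ¬ IsPowerMod q p a) ⇔ (¬ a ^ℤ L′ ≋ + 1 [mod prodFin ps ])
  nonpower-in-M⇔≉1 0<L = mk⇔ nonpower⇒≉1 ≉1⇒nonpower
    where
      instance
        L′≢0 : NonZero L′
        L′≢0 = ℕₚ.m*n≢0⇒m≢0 L′ {{subst NonZero L≡L′q (ℕ.>-nonZero 0<L)}}
      w : ℕ
      w = proj₁ (valuation-exists q-prime L′ (ℕ.>-nonZero⁻¹ L′))
      val-L′ : IsValuation q L′ w
      val-L′ = proj₂ (valuation-exists q-prime L′ (ℕ.>-nonZero⁻¹ L′))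
      val-L : IsValuation q L (suc w)
      val-L = subst (λ n → IsValuation q n (suc w)) (sym L≡L′q) (valuation-*q w q-prime val-L′)
      nonpower⇒≉1 : (∃ λ p → InM q L ps p × ¬ IsPowerMod q p a) → ¬ a ^ℤ L′ ≋ + 1 [mod prodFin ps ]
      nonpower⇒≉1 (_ , (i , refl , v , val-pᵢ , val-L-v) , ¬power) aᴸ′≋1 =
        ¬power (Equivalence.to (^≋1⇔powers w val-L′) aᴸ′≋1 i
          (subst (IsValuation q (ps i ∸ 1)) (valuation-unique {q = q} {v = v} {w = suc w} val-L-v val-L)
                 val-pᵢ))
      power? : ∀ i → Dec (IsPowerMod q (ps i) a)
      power? i = IsPowerMod-dec q (ps i) {{prime⇒nonZero (ps-prime i)}} a
      nonpower? : ∀ i → Dec (IsValuation q (ps i ∸ 1) (suc w) × ¬ IsPowerMod q (ps i) a)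
      nonpower? i = valuation-dec q (ps i ∸ 1) (suc w) ×-dec ¬? (power? i)
      ≉1⇒nonpower : ¬ a ^ℤ L′ ≋ + 1 [mod prodFin ps ] → ∃ λ p → InM q L ps p × ¬ IsPowerMod q p a
      ≉1⇒nonpower ≉1 =
        let i , val-pᵢ , ¬power = decidable-stable (Finₚ.any? nonpower?) λ ¬nonpower →
              ≉1 (Equivalence.from (^≋1⇔powers w val-L′) λ i val-pᵢ →
                    decidable-stable (power? i) (λ ¬power → ¬nonpower (i , val-pᵢ , ¬power)))
        in ps i , (i , refl , suc w , val-pᵢ , val-L) , ¬power

mainTheorem3 : (ℓ : ℕ) (ps : Fin ℓ → ℕ) →
    (∀ i → Prime (ps i)) → (∀ i j → ps i ≡ ps j → i ≡ j) →
    (a : ℤ) → CoprimeZ a (prodFin ps) →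
    (L : ℕ) → IsCarmichaelλ (prodFin ps) L →
    IsGenPrimRoot (prodFin ps) L a
      ⇔ (∀ q → Prime q → q ∣ L →
           ∃ λ p → InM q L ps p × ¬ IsPowerMod q p a)
mainTheorem3 ℓ ps ps-prime ps-injective a a⊥Π L (0<L , carmichael , _) = mk⇔ nonpowers generator
  where
    NonpowerIn-M : ℕ → Set
    NonpowerIn-M q = ∃ λ p → InM q L ps p × ¬ IsPowerMod q p a
    test : IsOrder (prodFin ps) a L ⇔ OrderTest (prodFin ps) a L
    test = order-test a 0<L (carmichael a a⊥Π)
    criterion : ∀ {q} L′ → Prime q → L ≡ L′ ℕ.* q →
                NonpowerIn-M q ⇔ (¬ a ^ℤ L′ ≋ + 1 [mod prodFin ps ])
    criterion L′ q-prime L≡L′q = nonpower-in-M⇔≉1 ps ps-prime ps-injective a a⊥Π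
      (ps∸1∣exponent ps ps-prime ps-injective L carmichael) L′ q-prime L≡L′q 0<L
    nonpowers : IsGenPrimRoot (prodFin ps) L a → ∀ q → Prime q → q ∣ L → NonpowerIn-M q
    nonpowers (_ , order) q q-prime (divides L′ L≡L′q) =
      Equivalence.from (criterion L′ q-prime L≡L′q) (Equivalence.to test order q L′ q-prime L≡L′q)
    generator : (∀ q → Prime q → q ∣ L → NonpowerIn-M q) → IsGenPrimRoot (prodFin ps) L a
    generator nonpower = a⊥Π , Equivalence.from test λ q L′ q-prime L≡L′q →
      Equivalence.to (criterion L′ q-prime L≡L′q) (nonpower q q-prime (divides L′ L≡L′q))
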